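{- The map $w\mapsto N(w)$ from $A^*$ to the set of $N$-tableaux on $A$ induces a well-defined bijection from the stylic monoid $\mathrm{Styl}(A)$ onto the set of all $N$-tableaux on $A$. That is, for $u,v\in A^*$ one has $N(u)=N(v)$ if and only if $u\equiv_{styl}v$, and every $N$-tableau on $A$ equals $N(w)$ for some $w\in A^*$.
   Context: $A$ is a finite totally ordered alphabet and $A^*$ the free monoid on $A$. A column is a subset of $A$, identified with the strictly decreasing word of its elements. For a column $\gamma$ and a letter $x$: if $x>y$ for all $y\in\gamma$, let $x\cdot\gamma=\gamma\cup\{x\}$; otherwise let $y$ be the smallest element of $\gamma$ with $y\geq x$ and let $x\cdot\gamma=(\gamma\setminus\{y\})\cup\{x\}$. This extends to a left action of $A^*$ on the set $\mathcal C(A)$ of columns by $(uv)\cdot\gamma=u\cdot(v\cdot\gamma)$ (the empty word acts trivially). $\mathrm{Styl}(A)$ is the monoid of maps $\mathcal C(A)\to\mathcal C(A)$ induced by words, and $u\equiv_{styl}v$ means $u\cdot\gamma=v\cdot\gamma$ for all columns $\gamma$. Tableaux are drawn in French convention: rows are numbered from the bottom (row 1 at the bottom), entries weakly increase left to right in rows and strictly increase bottom to top in columns. An $N$-tableau is a tableau whose rows are strictly increasing and in which each row, viewed as a subset of $A$, is contained in the row below it. $N$-insertion: for a strictly increasing row $B$ (a subset of $A$) and a letter $x$, the $N$-insertion of $x$ into $B$ produces the row $B\cup\{x\}$, and if there is a smallest element $y$ of $B$ strictly larger than $x$, a copy of $y$ is bumped (otherwise nothing is bumped). $N$-insertion of $x$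 into an $N$-tableau $T$: insert $x$ into the first row; if a letter is bumped, $N$-insert it into the second row (creating a new row if necessary), and so on until nothing is bumped. For a word $w=a_1\cdots a_n$, $N(w)$ is obtained from the empty tableau by $N$-inserting successively $a_1,a_2,\ldots,a_n$. -}

module Defs where

open import Data.Nat using (ℕ)
open import Data.Bool using (Bool; true; false)
open import Data.Fin using (Fin; _<_; _≤_)
open import Data.Fin.Properties using (<-cmp; _≤?_)
open import Data.Fin.Subset using (Subset; _∈_; _∪_; ⁅_⁆)
open import Data.Fin.Subset.Properties using (_∈?_)
open import Data.List using (List; []; _∷_; foldl; filter; allFin)
open import Data.List.Relation.Unary.All using (All)
open import Data.List.Relation.Unary.Linked using (Linked)
open import Data.List.Relation.Binary.Subset.Propositional using (_⊆_)
open import Data.Maybe using (Maybe; just; nothing)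
open import Data.Product using (_×_; _,_)
open import Data.Unit using (⊤)
open import Data.Empty using (⊥)
open import Data.Vec using (_[_]≔_)
open import Relation.Nullary.Decidable using (_×-dec_)
open import Relation.Binary using (tri<; tri≈; tri>)
open import Relation.Binary.PropositionalEquality using (_≡_)

-- The alphabet A is Fin n with its natural total order (every finite
-- totally ordered set is order-isomorphic to some Fin n).

Word : ℕ → Set
Word n = List (Fin n)

Column : ℕ → Set
Column n = Subset n

smallestGE : ∀ {n} → Fin n → Column n → Maybe (Fin n)
smallestGE {n} x γ with filter (λ y → (y ∈? γ) ×-dec (x ≤? y)) (allFin n)
... | []    = nothing
... | y ∷ _ = just y

actLetter : ∀ {n} → Fin n → Column n → Column n
actLetter x γ with smallestGE x γ
... | nothing = γ ∪ ⁅ x ⁆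
... | just y  = (γ [ y ]≔ false) [ x ]≔ true

act : ∀ {n} → Word n → Column n → Column n
act []      γ = γ
act (x ∷ w) γ = actLetter x (act w γ)

_≡styl_ : ∀ {n} → Word n → Word n → Set
u ≡styl v = ∀ γ → act u γ ≡ act v γ

-- Tableaux (French convention): a tableau is the list of its rows,
-- bottom row (row 1) first; each row is listed left to right.

Row : ℕ → Set
Row n = List (Fin n)

Tableau : ℕ → Set
Tableau n = List (Row n)

ColStrict : ∀ {n} → Row n → Row n → Set
ColStrict r       []      = ⊤
ColStrict []      (_ ∷ _) = ⊥
ColStrict (a ∷ r) (b ∷ s) = (a < b) × ColStrict r s

NonEmpty : ∀ {n} → Row n → Set
NonEmpty []      = ⊥
NonEmpty (_ ∷ _) = ⊤

IsNTableau : ∀ {n} → Tableau n → Set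
IsNTableau {n} T =
  All NonEmpty T ×
  All (Sorted' ) T ×
  Linked (λ r s → ColStrict r s × (s ⊆ r)) T
  where
  Sorted' : Row n → Set
  Sorted' = Linked _<_

-- N-insertion of x into a strictly increasing row B: the new row B ∪ {x}
-- and the bumped letter (smallest element of B strictly larger than x).
insertRow : ∀ {n} → Fin n → Row n → Row n × Maybe (Fin n)
insertRow x [] = (x ∷ [] , nothing)
insertRow x (b ∷ B) with <-cmp x b
... | tri< _ _ _ = (x ∷ b ∷ B , just b)
... | tri≈ _ _ _ with B
...   | []     = (b ∷ [] , nothing)
...   | c ∷ B' = (b ∷ c ∷ B' , just c)
insertRow x (b ∷ B) | tri> _ _ _ with insertRow x B
... | (B' , m) = (b ∷ B' , m)

insertT : ∀ {n} → Fin n → Tableau n → Tableau n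
insertT x [] = (x ∷ []) ∷ []
insertT x (r ∷ T) with insertRow x r
... | (r' , nothing) = r' ∷ T
... | (r' , just y)  = r' ∷ insertT y T

N : ∀ {n} → Word n → Tableau n
N w = foldl (λ T a → insertT a T) [] w

-- Inserting x into a strictly increasing row R, giving R′ and bumping y, is a stylic relation:
-- the word R x acts on columns like y R′. Hence the reading word of N(w) (its rows from top to
-- bottom) acts like w, and N(u) = N(v) gives u ≡styl v.
-- Conversely the action of the reading word of an N-tableau recovers the tableau. A column that
-- contains the relevant letters below x but nothing in a window [x, B) detects whether x occurs in
-- a word; this recovers the bottom row R, and the images under R of such test columns detect the
-- letters of the next row, and so on upwards.
-- Finally an N-tableau with bottom row R is N of R followed by the predecessors in R of the letters
-- of a preimage of the rows above: inserting the predecessor of y into R bumps exactly y.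

module Submission where

open import Defs
open import Data.Nat using (ℕ)
open import Data.Product using (_×_; ∃)
open import Function.Bundles using (_⇔_)
open import Relation.Binary.PropositionalEquality using (_≡_)

open import Data.Nat as ℕ using (zero; suc; s≤s; z≤n)
import Data.Nat.Properties as ℕ
open import Data.Bool using (true; false; _∧_)
open import Data.Bool.Properties using (∨-identityʳ; ∧-zeroʳ)
open import Data.Fin using (Fin; zero; suc; toℕ; _<_; _≤_; _≟_)
open import Data.Fin.Properties using (<-cmp; _≤?_; _<?_; <-trans; <-irrefl; <-asym)
open import Data.Fin.Subset using (_∪_; ⁅_⁆)
open import Data.Fin.Subset.Properties using (_∈?_; ∪-identityʳ)
open import Data.List using (List; []; _∷_; filter; allFin; tabulate; head; map; foldl; _++_; [_])
open import Data.List.Properties using (map-tabulate; foldl-++; ++-assoc; ++-identityʳ)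
open import Data.List.Relation.Unary.Linked using (Linked; []; [-]; _∷_)
import Data.List.Relation.Unary.Linked as Linked
open import Data.List.Relation.Unary.Linked.Properties using (Linked⇒All)
open import Data.List.Relation.Unary.All using (All; []; _∷_)
import Data.List.Relation.Unary.All as All
open import Data.List.Relation.Unary.Any using (here; there; any?)
open import Data.List.Membership.Propositional using (_∈_)
open import Data.List.Membership.Propositional.Properties using (∈-++⁻; ∈-++⁺ˡ; ∈-++⁺ʳ; ∈-map⁻)
open import Data.List.Relation.Binary.Subset.Propositional using (_⊆_)
open import Data.Maybe using (Maybe; just; nothing)
open import Data.Maybe.Relation.Binary.Connected using (Connected; just; just-nothing)
import Data.Maybe as Maybe
open import Data.Product using (_,_; proj₁; proj₂)
open import Data.Sum using (inj₁; inj₂)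
open import Data.Unit using (⊤; tt)
open import Data.Empty using (⊥; ⊥-elim)
open import Data.Vec using ([]; _∷_; lookup; _[_]≔_)
open import Relation.Nullary using (does; yes; no; ¬_)
open import Relation.Nullary.Decidable using (_×-dec_)
open import Relation.Unary using (Pred; Decidable)
open import Relation.Binary using (tri<; tri≈; tri>)
open import Relation.Binary.PropositionalEquality using (_≢_; refl; sym; trans; cong; cong₂; subst; module ≡-Reasoning)
open import Level using (0ℓ)
open import Function using (id; _∘_)
open import Function.Bundles using (mk⇔)

-- The stylic action on bit vectors

dropMin : ∀ {n} → Column n → Column n
dropMin []          = []
dropMin (true ∷ γ)  = false ∷ γ
dropMin (false ∷ γ) = false ∷ dropMin γ

infixr 5 _·_ _·*_

_·_ : ∀ {n} → Fin n → Column n → Column n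
zero  · (true ∷ γ)  = true ∷ γ
zero  · (false ∷ γ) = true ∷ dropMin γ
suc x · (b ∷ γ)     = b ∷ x · γ

_·*_ : ∀ {n} → Word n → Column n → Column n
[]      ·* γ = γ
(x ∷ w) ·* γ = x · w ·* γ

leastFrom : ∀ {n} → ℕ → Column n → Maybe (Fin n)
leastFrom k       []          = nothing
leastFrom zero    (true ∷ γ)  = just zero
leastFrom zero    (false ∷ γ) = Maybe.map suc (leastFrom zero γ)
leastFrom (suc k) (b ∷ γ)     = Maybe.map suc (leastFrom k γ)

module _ {n} {P : Pred (Fin (suc n)) 0ℓ} {Q : Pred (Fin n) 0ℓ} (P? : Decidable P) (Q? : Decidable Q)
         (P∘suc≗Q : ∀ y → does (P? (suc y)) ≡ does (Q? y)) where

  filter-map-suc : ∀ xs → filter P? (map suc xs) ≡ map suc (filter Q? xs)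
  filter-map-suc []       = refl
  filter-map-suc (x ∷ xs) with does (P? (suc x)) | does (Q? x) | P∘suc≗Q x
  ... | false | false | refl = filter-map-suc xs
  ... | true  | true  | refl = cong (suc x ∷_) (filter-map-suc xs)

  head-filter-allFin-suc : does (P? zero) ≡ false →
    head (filter P? (allFin (suc n))) ≡ Maybe.map suc (head (filter Q? (allFin n)))
  head-filter-allFin-suc ¬P0 with does (P? zero) | ¬P0
  ... | false | refl = begin
    head (filter P? (tabulate suc))              ≡⟨ cong (head ∘ filter P?) (sym (map-tabulate id suc)) ⟩
    head (filter P? (map suc (allFin n)))        ≡⟨ cong head (filter-map-suc (allFin n)) ⟩
    head (map suc (filter Q? (allFin n)))        ≡⟨ head-map (filter Q? (allFin n)) ⟩
    Maybe.map suc (head (filter Q? (allFin n)))  ∎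
    where
    open ≡-Reasoning
    head-map : ∀ xs → head (map suc xs) ≡ Maybe.map suc (head xs)
    head-map []      = refl
    head-map (_ ∷ _) = refl

leastFrom-filter : ∀ {n} k (γ : Column n) →
  head (filter (λ y → (y ∈? γ) ×-dec (k ℕ.≤? toℕ y)) (allFin n)) ≡ leastFrom k γ
leastFrom-filter {zero}  k       []          = refl
leastFrom-filter {suc n} zero    (true ∷ γ)  = refl
leastFrom-filter {suc n} zero    (false ∷ γ) =
  trans (head-filter-allFin-suc (λ y → (y ∈? false ∷ γ) ×-dec (0 ℕ.≤? toℕ y)) (λ y → (y ∈? γ) ×-dec (0 ℕ.≤? toℕ y))
                                (λ _ → refl) refl) (cong (Maybe.map suc) (leastFrom-filter zero γ))
leastFrom-filter {suc n} (suc k) (b ∷ γ)     =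
  trans (head-filter-allFin-suc (λ y → (y ∈? b ∷ γ) ×-dec (suc k ℕ.≤? toℕ y)) (λ y → (y ∈? γ) ×-dec (k ℕ.≤? toℕ y))
                                (λ y → cong (does (y ∈? γ) ∧_) (≤ᵇ-suc k (toℕ y))) (∧-zeroʳ _))
        (cong (Maybe.map suc) (leastFrom-filter k γ))
  where
  ≤ᵇ-suc : ∀ k m → (k ℕ.<ᵇ suc m) ≡ (k ℕ.≤ᵇ m)
  ≤ᵇ-suc zero    m = refl
  ≤ᵇ-suc (suc k) m = refl

replaceLeast : ∀ {n} → Maybe (Fin n) → Fin n → Column n → Column n
replaceLeast nothing  x γ = γ ∪ ⁅ x ⁆
replaceLeast (just y) x γ = (γ [ y ]≔ false) [ x ]≔ true

dropMin-via-leastFrom : ∀ {n} (γ : Column n) → dropMin γ ≡ Maybe.maybe (λ y → γ [ y ]≔ false) γ (leastFrom 0 γ)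
dropMin-via-leastFrom []          = refl
dropMin-via-leastFrom (true ∷ γ)  = refl
dropMin-via-leastFrom (false ∷ γ) with leastFrom 0 γ | dropMin-via-leastFrom γ
... | nothing | eq = cong (false ∷_) eq
... | just _  | eq = cong (false ∷_) eq

replaceLeast-leastFrom : ∀ {n} (x : Fin n) γ → replaceLeast (leastFrom (toℕ x) γ) x γ ≡ x · γ
replaceLeast-leastFrom zero    (true ∷ γ)  = refl
replaceLeast-leastFrom zero    (false ∷ γ) with leastFrom 0 γ | dropMin-via-leastFrom γ
... | nothing | eq = cong (true ∷_) (trans (∪-identityʳ γ) (sym eq))
... | just _  | eq = cong (true ∷_) (sym eq)
replaceLeast-leastFrom (suc x) (b ∷ γ)     with leastFrom (toℕ x) γ | replaceLeast-leastFrom x γ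
... | nothing | eq = cong₂ _∷_ (∨-identityʳ b) eq
... | just _  | eq = cong (b ∷_) eq

actLetter≡· : ∀ {n} (x : Fin n) γ → actLetter x γ ≡ x · γ
actLetter≡· {n} x γ = begin
  actLetter x γ                              ≡⟨ actLetter≡replaceLeast ⟩
  replaceLeast (smallestGE x γ) x γ          ≡⟨ cong (λ m → replaceLeast m x γ) smallestGE≡leastFrom ⟩
  replaceLeast (leastFrom (toℕ x) γ) x γ     ≡⟨ replaceLeast-leastFrom x γ ⟩
  x · γ                                      ∎
  where
  open ≡-Reasoning
  actLetter≡replaceLeast : actLetter x γ ≡ replaceLeast (smallestGE x γ) x γ
  actLetter≡replaceLeast with smallestGE x γ
  ... | nothing = refl
  ... | just _  = refl
  smallestGE≡leastFrom : smallestGE x γ ≡ leastFrom (toℕ x) γ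
  smallestGE≡leastFrom with filter (λ y → (y ∈? γ) ×-dec (x ≤? y)) (allFin n) | leastFrom-filter (toℕ x) γ
  ... | []    | eq = eq
  ... | _ ∷ _ | eq = eq

act≡·* : ∀ {n} (w : Word n) γ → act w γ ≡ w ·* γ
act≡·* []      γ = refl
act≡·* (x ∷ w) γ = trans (actLetter≡· x (act w γ)) (cong (x ·_) (act≡·* w γ))

·*-++ : ∀ {n} (u w : Word n) γ → (u ++ w) ·* γ ≡ u ·* w ·* γ
·*-++ []      w γ = refl
·*-++ (x ∷ u) w γ = cong (x ·_) (·*-++ u w γ)

·*-map-suc : ∀ {n} (w : Word n) b γ → map suc w ·* (b ∷ γ) ≡ b ∷ w ·* γ
·*-map-suc []      b γ = refl
·*-map-suc (x ∷ w) b γ = cong (suc x ·_) (·*-map-suc w b γ)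

·-idem : ∀ {n} (x : Fin n) γ → x · x · γ ≡ x · γ
·-idem zero    (true ∷ γ)  = refl
·-idem zero    (false ∷ γ) = refl
·-idem (suc x) (b ∷ γ)     = cong (b ∷_) (·-idem x γ)

·-mem : ∀ {n} (x : Fin n) γ → lookup (x · γ) x ≡ true
·-mem zero    (true ∷ γ)  = refl
·-mem zero    (false ∷ γ) = refl
·-mem (suc x) (b ∷ γ)     = ·-mem x γ

·-fix : ∀ {n} (x : Fin n) γ → lookup γ x ≡ true → x · γ ≡ γ
·-fix zero    (true ∷ γ) _  = refl
·-fix (suc x) (b ∷ γ)    eq = cong (b ∷_) (·-fix x γ eq)

·-below : ∀ {n} (x z : Fin n) γ → z < x → lookup (x · γ) z ≡ lookup γ z
·-below (suc x) zero    (b ∷ γ) _         = refl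
·-below (suc x) (suc z) (b ∷ γ) (s≤s z<x) = ·-below x z γ z<x

Sorted : ∀ {n} → List (Fin n) → Set
Sorted = Linked _<_

sorted⇒All> : ∀ {n} {a : Fin n} {xs} → Sorted (a ∷ xs) → All (a <_) xs
sorted⇒All> [-]      = []
sorted⇒All> (a<b ∷ s) = Linked⇒All <-trans a<b s

∈-tail : ∀ {n} {x z : Fin n} {xs} → x < z → z ∈ x ∷ xs → z ∈ xs
∈-tail x<x (here refl) = ⊥-elim (<-irrefl refl x<x)
∈-tail _   (there z∈)  = z∈

data SortedView {n} : List (Fin (suc n)) → Set where
  without0 : ∀ R → Sorted R → SortedView (map suc R)
  with0    : ∀ R → Sorted R → SortedView (zero ∷ map suc R)

sortedView : ∀ {n} (R : List (Fin (suc n))) → Sorted R → SortedView R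
sortedView []      _ = without0 [] []
sortedView (zero ∷ R) s with sortedView R (Linked.tail s) | s
... | without0 R′ s′ | _      = with0 R′ s′
... | with0 _ _      | () ∷ _
sortedView (suc b ∷ R) s with sortedView R (Linked.tail s) | s
... | without0 R′ s′ | s₀     = without0 (b ∷ R′) (unsuc s₀)
  where
  unsuc : ∀ {n} {b : Fin n} {R} → Sorted (suc b ∷ map suc R) → Sorted (b ∷ R)
  unsuc {R = []}    _               = [-]
  unsuc {R = _ ∷ R} (s≤s b<c ∷ s) = b<c ∷ unsuc s
... | with0 _ _      | () ∷ _

HasBelow : ∀ {n} → Fin n → Column n → Set
HasBelow zero    γ           = ⊥
HasBelow (suc y) (true ∷ γ)  = ⊤
HasBelow (suc y) (false ∷ γ) = HasBelow y γ

hasBelow : ∀ {n} (z y : Fin n) γ → lookup γ z ≡ true → z < y → HasBelow y γ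
hasBelow zero    (suc y) (true ∷ γ)  _  _         = tt
hasBelow (suc z) (suc y) (true ∷ γ)  _  _         = tt
hasBelow (suc z) (suc y) (false ∷ γ) eq (s≤s z<y) = hasBelow z y γ eq z<y

dropMin-·-comm : ∀ {n} (y : Fin n) γ → HasBelow y γ → dropMin (y · γ) ≡ y · dropMin γ
dropMin-·-comm (suc y) (true ∷ γ)  _ = refl
dropMin-·-comm (suc y) (false ∷ γ) h = cong (false ∷_) (dropMin-·-comm y γ h)

dropMin-·-dropMin : ∀ {n} (x : Fin n) γ → lookup γ x ≡ true → dropMin (x · dropMin γ) ≡ dropMin (dropMin γ)
dropMin-·-dropMin zero    (true ∷ γ)  _  = refl
dropMin-·-dropMin (suc x) (true ∷ γ)  eq = cong (λ δ → false ∷ dropMin δ) (·-fix x γ eq)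
dropMin-·-dropMin (suc x) (false ∷ γ) eq = cong (false ∷_) (dropMin-·-dropMin x γ eq)

sorted-·*-dropMin : ∀ {n} (h : Fin n) R → Sorted (h ∷ R) → ∀ γ →
  (h ∷ R) ·* dropMin γ ≡ h · dropMin ((h ∷ R) ·* γ)
sorted-·*-dropMin {suc n} h R s γ = go (h ∷ R) (sortedView (h ∷ R) s) γ refl
  where
  go : ∀ R′ → SortedView R′ → ∀ γ → R′ ≡ h ∷ R → R′ ·* dropMin γ ≡ h · dropMin (R′ ·* γ)
  go _ (without0 (h₁ ∷ R₁) s₁) (true ∷ γ) refl
    rewrite ·*-map-suc (h₁ ∷ R₁) false γ | ·*-map-suc (h₁ ∷ R₁) true γ
    = cong (false ∷_) (sym (·-idem h₁ (R₁ ·* γ)))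
  go _ (without0 (h₁ ∷ R₁) s₁) (false ∷ γ) refl
    rewrite ·*-map-suc (h₁ ∷ R₁) false (dropMin γ) | ·*-map-suc (h₁ ∷ R₁) false γ
    = cong (false ∷_) (sorted-·*-dropMin h₁ R₁ s₁ γ)
  go _ (with0 R₁ s₁) (true ∷ γ) refl
    rewrite ·*-map-suc R₁ false γ | ·*-map-suc R₁ true γ = refl
  go _ (with0 [] s₁) (false ∷ γ) refl = refl
  go _ (with0 (h₁ ∷ R₁) s₁) (false ∷ γ) refl
    rewrite ·*-map-suc (h₁ ∷ R₁) false (dropMin γ) | ·*-map-suc (h₁ ∷ R₁) false γ
    = cong (true ∷_) (trans (cong dropMin (sorted-·*-dropMin h₁ R₁ s₁ γ))
                            (dropMin-·-dropMin h₁ ((h₁ ∷ R₁) ·* γ) (·-mem h₁ (R₁ ·* γ))))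

-- Row insertion as a stylic relation

Insertion : ℕ → Set
Insertion n = Row n × Maybe (Fin n)

rowWord : ∀ {n} → Insertion n → Word n
rowWord (R , nothing) = R
rowWord (R , just y)  = y ∷ R

liftInsertion : ∀ {n} → Insertion n → Insertion (suc n)
liftInsertion (R , m) = map suc R , Maybe.map suc m

consInsertion : ∀ {n} → Fin n → Insertion n → Insertion n
consInsertion b (R , m) = b ∷ R , m

rowWord-lift : ∀ {n} (P : Insertion n) b γ → rowWord (liftInsertion P) ·* (b ∷ γ) ≡ b ∷ rowWord P ·* γ
rowWord-lift (R , nothing) = ·*-map-suc R
rowWord-lift (R , just y)  = ·*-map-suc (y ∷ R)

insertRow-skip : ∀ {n} (x b : Fin n) B → b < x → insertRow x (b ∷ B) ≡ consInsertion b (insertRow x B)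
insertRow-skip x b B b<x with <-cmp x b
... | tri< x<b _ _ = ⊥-elim (<-asym b<x x<b)
... | tri≈ _ refl _ = ⊥-elim (<-irrefl refl b<x)
... | tri> _ _ _ with insertRow x B
...   | _ , _ = refl

insertRow-suc : ∀ {n} (x : Fin n) R → insertRow (suc x) (map suc R) ≡ liftInsertion (insertRow x R)
insertRow-suc x []      = refl
insertRow-suc x (b ∷ B) with <-cmp x b
... | tri< _ _ _ = refl
... | tri≈ _ _ _ with B
...   | []    = refl
...   | _ ∷ _ = refl
insertRow-suc x (b ∷ B) | tri> _ _ _ with insertRow x B | insertRow-suc x B
...   | _ , _ | eq rewrite eq = refl

BumpedAbove : ∀ {n} → Fin n → Insertion n → Set
BumpedAbove x (_ , nothing)     = ⊤
BumpedAbove x ([] , just y)     = ⊥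
BumpedAbove x (b ∷ _ , just y)  = x < y × b < y

bumpedAbove : ∀ {n} (x : Fin n) R → Sorted R → BumpedAbove x (insertRow x R)
bumpedAbove x []      _ = tt
bumpedAbove x (b ∷ B) s with <-cmp x b
... | tri< x<b _ _ = x<b , x<b
... | tri≈ _ refl _ with B | s
...   | []     | _       = tt
...   | _ ∷ _  | b<c ∷ _ = b<c , b<c
bumpedAbove x (b ∷ B) s | tri> _ _ b<x with insertRow x B | bumpedAbove x B (Linked.tail s)
...   | _ , nothing     | _         = tt
...   | _ ∷ _ , just y  | x<y , _   = x<y , <-trans b<x x<y

bumped-hasBelow : ∀ {n} (x y : Fin n) R γ → BumpedAbove x (R , just y) → HasBelow y (R ·* γ)
bumped-hasBelow x y (b ∷ R) γ (_ , b<y) = hasBelow b y ((b ∷ R) ·* γ) (·-mem b (R ·* γ)) b<y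

·-zero-consInsertion : ∀ {n} (x : Fin n) P b γ → BumpedAbove x P →
  zero · (b ∷ rowWord P ·* γ) ≡ rowWord (consInsertion zero (liftInsertion P)) ·* (b ∷ γ)
·-zero-consInsertion x (R , nothing) b γ _ rewrite ·*-map-suc R b γ = refl
·-zero-consInsertion x (R , just y) true γ _ rewrite ·*-map-suc R true γ = refl
·-zero-consInsertion x (R , just y) false γ ab rewrite ·*-map-suc R false γ =
  cong (true ∷_) (dropMin-·-comm y (R ·* γ) (bumped-hasBelow x y R γ ab))

·*-insertRow : ∀ {n} (x : Fin n) R → Sorted R → ∀ γ → R ·* x · γ ≡ rowWord (insertRow x R) ·* γ
·*-insertRow {suc n} x R s γ = go x R (sortedView R s) γ
  where
  go : ∀ (x : Fin (suc n)) R → SortedView R → ∀ γ → R ·* x · γ ≡ rowWord (insertRow x R) ·* γ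
  go (suc x) _ (without0 R₁ s₁) (b ∷ γ)
    rewrite ·*-map-suc R₁ b (x · γ) | ·*-insertRow x R₁ s₁ γ | insertRow-suc x R₁
    = sym (rowWord-lift (insertRow x R₁) b γ)
  go (suc x) _ (with0 R₁ s₁) (b ∷ γ)
    rewrite ·*-map-suc R₁ b (x · γ) | ·*-insertRow x R₁ s₁ γ
          | insertRow-skip (suc x) zero (map suc R₁) (s≤s z≤n) | insertRow-suc x R₁
    = ·-zero-consInsertion x (insertRow x R₁) b γ (bumpedAbove x R₁ s₁)
  go zero _ (without0 [] _) (b ∷ γ) = refl
  go zero _ (without0 (h ∷ R₂) s₁) (true ∷ γ)
    rewrite ·*-map-suc (h ∷ R₂) true γ = cong (true ∷_) (sym (·-idem h (R₂ ·* γ)))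
  go zero _ (without0 (h ∷ R₂) s₁) (false ∷ γ)
    rewrite ·*-map-suc (h ∷ R₂) true (dropMin γ) | ·*-map-suc (h ∷ R₂) false γ
    = cong (true ∷_) (sorted-·*-dropMin h R₂ s₁ γ)
  go zero _ (with0 [] _) (b ∷ γ) = ·-idem zero (b ∷ γ)
  go zero _ (with0 (h ∷ R₂) s₁) (true ∷ γ)
    rewrite ·*-map-suc (h ∷ R₂) true γ = cong (true ∷_) (sym (·-idem h (R₂ ·* γ)))
  go zero _ (with0 (h ∷ R₂) s₁) (false ∷ γ)
    rewrite ·*-map-suc (h ∷ R₂) true (dropMin γ) | ·*-map-suc (h ∷ R₂) false γ
    = cong (true ∷_) (sorted-·*-dropMin h R₂ s₁ γ)

Exceeds : ∀ {n} → Row n → Fin n → Set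
Exceeds r z = ∃ λ w → w ∈ r × w < z

Stacked : ∀ {n} → Row n → Row n → Set
Stacked r s = ColStrict r s × s ⊆ r

colStrict⇒exceeds : ∀ {n} (r s : Row n) → Sorted s → ColStrict r s → ∀ {z} → z ∈ s → Exceeds r z
colStrict⇒exceeds (a ∷ r) (b ∷ s) _  (a<b , _) (here refl) = a , here refl , a<b
colStrict⇒exceeds (a ∷ r) (b ∷ s) ss (a<b , _) (there z∈)  = a , here refl , <-trans a<b (All.lookup (sorted⇒All> ss) z∈)

stacked-letters : ∀ {n} (r s : Row n) → Sorted s → Stacked r s → ∀ {z} → z ∈ s → z ∈ r × Exceeds r z
stacked-letters r s ss (cs , s⊆r) z∈ = s⊆r z∈ , colStrict⇒exceeds r s ss cs z∈

-- A weakening of the column condition of N-tableaux that insertion visibly preserves; for sorted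
-- rows it implies ColStrict.
Supports : ∀ {n} → Row n → Row n → Set
Supports r s = s ⊆ r × (∀ {z} → z ∈ s → Exceeds r z)

SupportsTop : ∀ {n} → Row n → Tableau n → Set
SupportsTop r T = Connected Supports (just r) (head T)

WeakNTableau : ∀ {n} → Tableau n → Set
WeakNTableau T = All NonEmpty T × All Sorted T × Linked Supports T

supportsTop-mono : ∀ {n} {r r′ : Row n} T → r ⊆ r′ → SupportsTop r T → SupportsTop r′ T
supportsTop-mono []      _    just-nothing          = just-nothing
supportsTop-mono (_ ∷ _) r⊆r′ (just (s⊆r , above)) =
  just ((r⊆r′ ∘ s⊆r) , λ z∈s → let w , w∈r , w<z = above z∈s in w , r⊆r′ w∈r , w<z)

sorted-∷ : ∀ {n} {a : Fin n} {xs} → All (a <_) xs → Sorted xs → Sorted (a ∷ xs)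
sorted-∷ []        _ = [-]
sorted-∷ (a<b ∷ _) s = a<b ∷ s

record RowInsertion {n} (x : Fin n) (R R′ : Row n) (m : Maybe (Fin n)) : Set where
  field
    sorted    : Sorted R′
    ⊆-∷       : R′ ⊆ x ∷ R
    inserted  : x ∈ R′
    ⊆-old     : R ⊆ R′
    bumped-∈  : Maybe.maybe (_∈ R) ⊤ m

rowInsertion : ∀ {n} (x : Fin n) R → Sorted R → RowInsertion x R (proj₁ (insertRow x R)) (proj₂ (insertRow x R))
rowInsertion x []      s = record { sorted = [-] ; ⊆-∷ = id ; inserted = here refl ; ⊆-old = λ () ; bumped-∈ = tt }
rowInsertion x (b ∷ B) s with <-cmp x b
... | tri< x<b _ _ =
  record { sorted = x<b ∷ s ; ⊆-∷ = id ; inserted = here refl ; ⊆-old = there ; bumped-∈ = here refl }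
... | tri≈ _ refl _ with B | s
...   | []     | _  = record { sorted = [-] ; ⊆-∷ = there ; inserted = here refl ; ⊆-old = id ; bumped-∈ = tt }
...   | _ ∷ _  | s′ = record { sorted = s′ ; ⊆-∷ = there ; inserted = here refl ; ⊆-old = id ; bumped-∈ = there (here refl) }
rowInsertion x (b ∷ B) s | tri> _ _ b<x with insertRow x B | rowInsertion x B (Linked.tail s)
...   | B′ , m | ri = record
  { sorted   = sorted-∷ (All.tabulate (b<new ∘ ri .⊆-∷)) (ri .sorted)
  ; ⊆-∷      = λ { (here refl) → there (here refl) ; (there z∈B′) → swap (ri .⊆-∷ z∈B′) }
  ; inserted = there (ri .inserted)
  ; ⊆-old    = λ { (here refl) → here refl ; (there z∈B) → there (ri .⊆-old z∈B) }
  ; bumped-∈ = bumped m (ri .bumped-∈)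
  }
  where
  open RowInsertion
  b<new : ∀ {z} → z ∈ x ∷ B → b < z
  b<new (here refl) = b<x
  b<new (there z∈B) = All.lookup (sorted⇒All> s) z∈B
  swap : ∀ {z} → z ∈ x ∷ B → z ∈ x ∷ b ∷ B
  swap (here eq)   = here eq
  swap (there z∈B) = there (there z∈B)
  bumped : ∀ m → Maybe.maybe (_∈ B) ⊤ m → Maybe.maybe (_∈ b ∷ B) ⊤ m
  bumped nothing  _   = tt
  bumped (just _) y∈B = there y∈B

bumped>inserted : ∀ {n} {x y : Fin n} R → BumpedAbove x (R , just y) → x < y
bumped>inserted (_ ∷ _) (x<y , _) = x<y

∈⇒nonEmpty : ∀ {n} {x : Fin n} {R} → x ∈ R → NonEmpty R
∈⇒nonEmpty (here _)  = tt
∈⇒nonEmpty (there _) = tt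

supports-insert : ∀ {n} {P S S′ : Row n} {z} → Supports P S → z ∈ P → Exceeds P z → S′ ⊆ z ∷ S → Supports P S′
supports-insert {P = P} {S} {z = z} (S⊆P , above) z∈P z-exceeds S′⊆ = in-P ∘ S′⊆ , exceeds ∘ S′⊆
  where
  in-P : ∀ {w} → w ∈ z ∷ S → w ∈ P
  in-P (here refl) = z∈P
  in-P (there w∈S) = S⊆P w∈S
  exceeds : ∀ {w} → w ∈ z ∷ S → Exceeds P w
  exceeds (here refl) = z-exceeds
  exceeds (there w∈S) = above w∈S

supportsTop-insertT : ∀ {n} (T : Tableau n) z P → All Sorted T → SupportsTop P T → z ∈ P → Exceeds P z →
  SupportsTop P (insertT z T)
supportsTop-insertT []      z P _ _ z∈P z-exceeds =
  just ((λ { (here refl) → z∈P }) , (λ { (here refl) → z-exceeds }))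
supportsTop-insertT (S ∷ T) z P (sS ∷ _) (just supp) z∈P z-exceeds
  with insertRow z S | RowInsertion.⊆-∷ (rowInsertion z S sS)
... | S′ , nothing | S′⊆ = just (supports-insert supp z∈P z-exceeds S′⊆)
... | S′ , just _  | S′⊆ = just (supports-insert supp z∈P z-exceeds S′⊆)

insertT-weakNTableau : ∀ {n} (T : Tableau n) x → WeakNTableau T → WeakNTableau (insertT x T)
insertT-weakNTableau []      x _ = tt ∷ [] , [-] ∷ [] , [-]
insertT-weakNTableau (R ∷ T) x (_ ∷ nes , sR ∷ ss , lk)
  with insertRow x R | rowInsertion x R sR | bumpedAbove x R sR
... | R′ , nothing | ri | _ =
  ∈⇒nonEmpty (ri .inserted) ∷ nes , ri .sorted ∷ ss ,
  supportsTop-mono T (ri .⊆-old) (Linked.head′ lk) Linked.∷′ Linked.tail lk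
  where open RowInsertion
... | R′ , just z  | ri | ab with insertT-weakNTableau T z (nes , ss , Linked.tail lk)
...   | nes′ , ss′ , lk′ =
  ∈⇒nonEmpty (ri .inserted) ∷ nes′ , ri .sorted ∷ ss′ ,
  supportsTop-insertT T z R′ ss (supportsTop-mono T (ri .⊆-old) (Linked.head′ lk)) (ri .⊆-old (ri .bumped-∈))
                      (x , ri .inserted , bumped>inserted R′ ab)
  Linked.∷′ lk′
  where open RowInsertion

insertAll : ∀ {n} → Tableau n → Word n → Tableau n
insertAll = foldl (λ T a → insertT a T)

N-weakNTableau : ∀ {n} (w : Word n) → WeakNTableau (N w)
N-weakNTableau w = go [] w ([] , [] , [])
  where
  go : ∀ T w → WeakNTableau T → WeakNTableau (insertAll T w)
  go T []      wT = wT
  go T (x ∷ w) wT = go (insertT x T) w (insertT-weakNTableau T x wT)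

supports⇒colStrict : ∀ {n} (r s : Row n) → Sorted r → Sorted s → Supports r s → ColStrict r s
supports⇒colStrict r       []      _  _  _              = tt
supports⇒colStrict []      (b ∷ s) _  _  (s⊆r , _)      with s⊆r (here refl)
... | ()
supports⇒colStrict (a ∷ r) (b ∷ s) sr ss (s⊆r , above) =
  a<b , supports⇒colStrict r s (Linked.tail sr) (Linked.tail ss)
          ((λ m → ∈-tail (<-trans a<b (b<s m)) (s⊆r (there m))) ,
           (λ m → b , ∈-tail a<b (s⊆r (here refl)) , b<s m))
  where
  b<s : ∀ {z} → z ∈ s → b < z
  b<s = All.lookup (sorted⇒All> ss)
  a<b : a < b
  a<b with above (here refl)
  ... | _ , here refl , w<b = w<b
  ... | _ , there w∈r , w<b = <-trans (All.lookup (sorted⇒All> sr) w∈r) w<b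

weakNTableau⇒isNTableau : ∀ {n} (T : Tableau n) → WeakNTableau T → IsNTableau T
weakNTableau⇒isNTableau T (nes , ss , lk) = nes , ss , go T ss lk
  where
  go : ∀ T → All Sorted T → Linked Supports T → Linked Stacked T
  go []          _             _                = []
  go (_ ∷ [])    _             _                = [-]
  go (R ∷ S ∷ T) (sR ∷ sS ∷ ss) (supp ∷ lk) = (supports⇒colStrict R S sR sS supp , proj₁ supp) ∷ go (S ∷ T) (sS ∷ ss) lk

reading : ∀ {n} → Tableau n → Word n
reading []      = []
reading (R ∷ T) = reading T ++ R

reading-insertT : ∀ {n} (T : Tableau n) → All Sorted T → ∀ x γ → reading (insertT x T) ·* γ ≡ reading T ·* x · γ
reading-insertT []      _         x γ = refl
reading-insertT (R ∷ T) (sR ∷ ss) x γ with insertRow x R | ·*-insertRow x R sR γ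
... | R′ , nothing | eq = begin
  reading (R′ ∷ T) ·* γ             ≡⟨ ·*-++ (reading T) R′ γ ⟩
  reading T ·* R′ ·* γ              ≡⟨ cong (reading T ·*_) (sym eq) ⟩
  reading T ·* R ·* x · γ           ≡⟨ ·*-++ (reading T) R (x · γ) ⟨
  reading (R ∷ T) ·* x · γ          ∎
  where open ≡-Reasoning
... | R′ , just y  | eq = begin
  reading (R′ ∷ insertT y T) ·* γ   ≡⟨ ·*-++ (reading (insertT y T)) R′ γ ⟩
  reading (insertT y T) ·* R′ ·* γ  ≡⟨ reading-insertT T ss y (R′ ·* γ) ⟩
  reading T ·* y · R′ ·* γ          ≡⟨ cong (reading T ·*_) (sym eq) ⟩
  reading T ·* R ·* x · γ           ≡⟨ ·*-++ (reading T) R (x · γ) ⟨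
  reading (R ∷ T) ·* x · γ          ∎
  where open ≡-Reasoning

reading-N : ∀ {n} (w : Word n) γ → reading (N w) ·* γ ≡ w ·* γ
reading-N w γ = go [] w ([] , [] , []) γ
  where
  go : ∀ T w → WeakNTableau T → ∀ γ → reading (insertAll T w) ·* γ ≡ reading T ·* w ·* γ
  go T []      _  γ = refl
  go T (x ∷ w) wT@(_ , ss , _) γ = trans (go (insertT x T) w (insertT-weakNTableau T x wT) γ)
                                         (reading-insertT T ss x (w ·* γ))

act-N : ∀ {n} (w : Word n) γ → act w γ ≡ reading (N w) ·* γ
act-N w γ = trans (act≡·* w γ) (sym (reading-N w γ))

predAfter : ∀ {n} → Fin n → Row n → Fin n → Fin n
predAfter a []      y = y
predAfter a (b ∷ R) y with b ≟ y
... | yes _ = a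
... | no _  = predAfter b R y

predIn : ∀ {n} → Row n → Fin n → Fin n
predIn []      y = y
predIn (a ∷ R) = predAfter a R

insertRow-member : ∀ {n} (a b : Fin n) R → insertRow a (a ∷ b ∷ R) ≡ (a ∷ b ∷ R , just b)
insertRow-member a b R with <-cmp a a
... | tri< a<a _ _ = ⊥-elim (<-irrefl refl a<a)
... | tri≈ _ _ _   = refl
... | tri> _ _ a<a = ⊥-elim (<-irrefl refl a<a)

insertRow-predAfter : ∀ {n} (a : Fin n) R y → Sorted (a ∷ R) → y ∈ R →
  predAfter a R y ∈ a ∷ R × insertRow (predAfter a R y) (a ∷ R) ≡ (a ∷ R , just y)
insertRow-predAfter a (b ∷ R) y s y∈ with b ≟ y
... | yes refl = here refl , insertRow-member a b R
insertRow-predAfter a (b ∷ R) y s (here refl)  | no b≢b = ⊥-elim (b≢b refl)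
insertRow-predAfter a (b ∷ R) y s (there y∈R) | no _ with insertRow-predAfter b R y (Linked.tail s) y∈R
... | p∈ , ins =
  there p∈ , trans (insertRow-skip _ a (b ∷ R) (All.lookup (sorted⇒All> s) p∈)) (cong (consInsertion a) ins)

insertRow-predIn : ∀ {n} (R : Row n) y → Sorted R → y ∈ R → Exceeds R y →
  predIn R y ∈ R × insertRow (predIn R y) R ≡ (R , just y)
insertRow-predIn (a ∷ R) y s (there y∈R) _ = insertRow-predAfter a R y s y∈R
insertRow-predIn (a ∷ R) a s (here refl) (w , w∈ , w<a) = ⊥-elim (<-irrefl refl (ℕ.<-≤-trans w<a (a-least w∈)))
  where
  a-least : ∀ {z} → z ∈ a ∷ R → a ≤ z
  a-least (here refl) = ℕ.≤-refl
  a-least (there z∈)  = ℕ.<⇒≤ (All.lookup (sorted⇒All> s) z∈)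

insertAll-predIn : ∀ {n} (R : Row n) T v → Sorted R → All (λ y → y ∈ R × Exceeds R y) v →
  insertAll (R ∷ T) (map (predIn R) v) ≡ R ∷ insertAll T v
insertAll-predIn R T []      _ _                  = refl
insertAll-predIn R T (y ∷ v) s ((y∈ , y>) ∷ rest) with insertRow-predIn R y s y∈ y>
... | _ , ins rewrite ins = insertAll-predIn R (insertT y T) v s rest

sorted-++⇒All< : ∀ {n} (S : Row n) x R → Sorted (S ++ x ∷ R) → All (_< x) S
sorted-++⇒All< []      x R _ = []
sorted-++⇒All< (a ∷ S) x R s =
  All.lookup (sorted⇒All> s) (∈-++⁺ʳ S (here refl)) ∷ sorted-++⇒All< S x R (Linked.tail s)

insertRow-append : ∀ {n} (x : Fin n) S → All (_< x) S → insertRow x S ≡ (S ++ [ x ] , nothing)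
insertRow-append x []      _          = refl
insertRow-append x (b ∷ S) (b<x ∷ S<x) = trans (insertRow-skip x b S b<x) (cong (consInsertion b) (insertRow-append x S S<x))

insertAll-sorted : ∀ {n} (S R : Row n) → Sorted (S ++ R) → insertAll (S ∷ []) R ≡ (S ++ R) ∷ []
insertAll-sorted S []      _ = cong [_] (sym (++-identityʳ S))
insertAll-sorted S (x ∷ R) s rewrite insertRow-append x S (sorted-++⇒All< S x R s) =
  trans (insertAll-sorted (S ++ [ x ]) R (subst Sorted (sym (++-assoc S [ x ] R)) s))
        (cong [_] (++-assoc S [ x ] R))

preimage : ∀ {n} → Tableau n → Word n
preimage []      = []
preimage (R ∷ T) = R ++ map (predIn R) (preimage T)

preimage-⊆ : ∀ {n} (R : Row n) T → All Sorted (R ∷ T) → Linked Stacked (R ∷ T) → preimage (R ∷ T) ⊆ R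
preimage-letters : ∀ {n} (R : Row n) T → All Sorted T → Linked Stacked (R ∷ T) →
  All (λ y → y ∈ R × Exceeds R y) (preimage T)

preimage-⊆ R T (sR ∷ ss) lk z∈ with ∈-++⁻ R z∈
... | inj₁ z∈R = z∈R
... | inj₂ z∈preds with ∈-map⁻ (predIn R) z∈preds
...   | y , y∈ , refl with All.lookup (preimage-letters R T ss lk) y∈
...     | y∈R , y> = proj₁ (insertRow-predIn R y sR y∈R y>)

preimage-letters R []       _          _                  = []
preimage-letters R (S ∷ T′) (sS ∷ ss′) (st ∷ lk′) =
  All.tabulate (stacked-letters R S sS st ∘ preimage-⊆ S T′ (sS ∷ ss′) lk′)

N-preimage : ∀ {n} (T : Tableau n) → IsNTableau T → N (preimage T) ≡ T
N-preimage []      _                                  = refl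
N-preimage (R ∷ T) (neR ∷ nes , sR ∷ ss , lk) = begin
  insertAll [] (R ++ map (predIn R) (preimage T))          ≡⟨ foldl-++ _ [] R _ ⟩
  insertAll (insertAll [] R) (map (predIn R) (preimage T)) ≡⟨ cong (λ T₀ → insertAll T₀ (map (predIn R) (preimage T))) (N-row R sR neR) ⟩
  insertAll (R ∷ []) (map (predIn R) (preimage T))         ≡⟨ insertAll-predIn R [] (preimage T) sR (preimage-letters R T ss lk) ⟩
  R ∷ N (preimage T)                                       ≡⟨ cong (R ∷_) (N-preimage T (nes , ss , Linked.tail lk)) ⟩
  R ∷ T                                                    ∎
  where
  open ≡-Reasoning
  N-row : ∀ R → Sorted R → NonEmpty R → insertAll [] R ≡ R ∷ []
  N-row (a ∷ R) s _ = insertAll-sorted [ a ] R s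

-- The action of the reading word determines the tableau

-- The bound B of the window [a, B) is a natural number so that the window can reach past the last letter.

EmptyOn : ∀ {n} → Fin n → ℕ → Column n → Set
EmptyOn a B γ = ∀ z → a ≤ z → toℕ z ℕ.< B → lookup γ z ≡ false

dropMin-∉ : ∀ {n} (γ : Column n) z → lookup γ z ≡ false → lookup (dropMin γ) z ≡ false
dropMin-∉ (true ∷ γ)  zero    _  = refl
dropMin-∉ (false ∷ γ) zero    _  = refl
dropMin-∉ (true ∷ γ)  (suc z) eq = eq
dropMin-∉ (false ∷ γ) (suc z) eq = dropMin-∉ γ z eq

dropMin-least : ∀ {n} (γ : Column n) c → lookup γ c ≡ true → (∀ z → z < c → lookup γ z ≡ false) →
  lookup (dropMin γ) c ≡ false × (∀ z → c < z → lookup (dropMin γ) z ≡ lookup γ z)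
dropMin-least (true ∷ γ)  zero    _  _     = refl , λ { (suc z) _ → refl }
dropMin-least (true ∷ γ)  (suc c) _  least with least zero ℕ.z<s
... | ()
dropMin-least (false ∷ γ) (suc c) eq least =
  let ∉ , above = dropMin-least γ c eq (λ z z<c → least (suc z) (s≤s z<c)) in
  ∉ , λ { (suc z) (s≤s c<z) → above z c<z }

·-emptyOn : ∀ {n} (a : Fin n) B γ → EmptyOn a B γ → ∀ z → a < z → toℕ z ℕ.< B → lookup (a · γ) z ≡ false
·-emptyOn zero    (suc B) (true ∷ γ)  empty (suc z) _         _         with empty zero z≤n (s≤s z≤n)
... | ()
·-emptyOn zero    (suc B) (false ∷ γ) empty (suc z) _         z<B       = dropMin-∉ γ z (empty (suc z) z≤n z<B)
·-emptyOn (suc a) (suc B) (b ∷ γ)     empty (suc z) (s≤s a<z) (s≤s z<B) =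
  ·-emptyOn a B γ (λ z′ a≤z′ z′<B → empty (suc z′) (s≤s a≤z′) (s≤s z′<B)) z a<z z<B

·-evicts : ∀ {n} (a c : Fin n) γ → a < c → lookup γ c ≡ true → (∀ z → a ≤ z → z < c → lookup γ z ≡ false) →
  lookup (a · γ) c ≡ false × (∀ z → c < z → lookup (a · γ) z ≡ lookup γ z)
·-evicts zero    (suc c) (true ∷ γ)  _         _  gap with gap zero z≤n ℕ.z<s
... | ()
·-evicts zero    (suc c) (false ∷ γ) _         eq gap =
  let ∉ , above = dropMin-least γ c eq (λ z z<c → gap (suc z) z≤n (s≤s z<c)) in
  ∉ , λ { (suc z) (s≤s c<z) → above z c<z }
·-evicts (suc a) (suc c) (b ∷ γ)     (s≤s a<c) eq gap =
  let ∉ , above = ·-evicts a c γ a<c eq (λ z a≤z z<c → gap (suc z) (s≤s a≤z) (s≤s z<c)) in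
  ∉ , λ { (suc z) (s≤s c<z) → above z c<z }

·*-below : ∀ {n} (w : Word n) z γ → All (z <_) w → lookup (w ·* γ) z ≡ lookup γ z
·*-below []      z γ _           = refl
·*-below (x ∷ w) z γ (z<x ∷ z<w) = trans (·-below x z (w ·* γ) z<x) (·*-below w z γ z<w)

·*-fix : ∀ {n} (w : Word n) γ → (∀ {z} → z ∈ w → lookup γ z ≡ true) → w ·* γ ≡ γ
·*-fix []      γ _  = refl
·*-fix (x ∷ w) γ w⊆γ rewrite ·*-fix w γ (w⊆γ ∘ there) = ·-fix x γ (w⊆γ (here refl))

ContainsBelow : ∀ {n} → Word n → Fin n → Column n → Set
ContainsBelow w x γ = ∀ {z} → z ∈ w → z < x → lookup γ z ≡ true

·*-keeps-below : ∀ {n} (w : Word n) x γ → ContainsBelow w x γ →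
  ∀ z → z < x → lookup γ z ≡ true → lookup (w ·* γ) z ≡ true
·*-small-letter : ∀ {n} (y : Fin n) w x γ → ContainsBelow (y ∷ w) x γ → y < x → y · w ·* γ ≡ w ·* γ

·*-keeps-below []      x γ _    z _   z∈γ = z∈γ
·*-keeps-below (y ∷ w) x γ cont z z<x z∈γ with y <? x
... | yes y<x rewrite ·*-small-letter y w x γ cont y<x = ·*-keeps-below w x γ (cont ∘ there) z z<x z∈γ
... | no  y≮x = trans (·-below y z (w ·* γ) (ℕ.<-≤-trans z<x (ℕ.≮⇒≥ y≮x)))
                      (·*-keeps-below w x γ (cont ∘ there) z z<x z∈γ)

·*-small-letter y w x γ cont y<x =
  ·-fix y (w ·* γ) (·*-keeps-below w x γ (cont ∘ there) y y<x (cont (here refl) y<x))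

·*-∈ : ∀ {n} (w : Word n) x γ → ContainsBelow w x γ → x ∈ w → lookup (w ·* γ) x ≡ true
·*-∈ (y ∷ w) x γ cont x∈ with <-cmp y x | x∈
... | tri≈ _ refl _ | _         = ·-mem y (w ·* γ)
... | tri< y<x _ _  | here refl = ⊥-elim (<-irrefl refl y<x)
... | tri< y<x _ _  | there x∈w rewrite ·*-small-letter y w x γ cont y<x = ·*-∈ w x γ (cont ∘ there) x∈w
... | tri> _ _ x<y  | here refl = ⊥-elim (<-irrefl refl x<y)
... | tri> _ _ x<y  | there x∈w = trans (·-below y x (w ·* γ) x<y) (·*-∈ w x γ (cont ∘ there) x∈w)

·*-∉ : ∀ {n} (w : Word n) x γ → ContainsBelow w x γ → ¬ x ∈ w → lookup (w ·* γ) x ≡ lookup γ x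
·*-∉ []      x γ _    _  = refl
·*-∉ (y ∷ w) x γ cont x∉ with <-cmp y x
... | tri< y<x _ _ rewrite ·*-small-letter y w x γ cont y<x = ·*-∉ w x γ (cont ∘ there) (x∉ ∘ there)
... | tri≈ _ refl _ = ⊥-elim (x∉ (here refl))
... | tri> _ _ x<y = trans (·-below y x (w ·* γ) x<y) (·*-∉ w x γ (cont ∘ there) (x∉ ∘ there))

·*-emptyOn-below : ∀ {n} (a a′ : Fin n) Hi B γ → Sorted (a′ ∷ Hi) → EmptyOn a B γ →
  ∀ y → a ≤ y → y < a′ → toℕ y ℕ.< B → lookup ((a′ ∷ Hi) ·* γ) y ≡ false
·*-emptyOn-below a a′ Hi B γ s empty y a≤y y<a′ y<B =
  trans (·*-below (a′ ∷ Hi) y γ (Linked⇒All <-trans y<a′ s)) (empty y a≤y y<B)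

-- Each letter of Hi is evicted again by its predecessor in the word.
sorted-·*-gap : ∀ {n} (a : Fin n) Hi B γ → Sorted (a ∷ Hi) → EmptyOn a B γ →
  ∀ z → a < z → toℕ z ℕ.< B → lookup ((a ∷ Hi) ·* γ) z ≡ false
sorted-·*-gap a []        B γ _            empty = ·-emptyOn a B γ empty
sorted-·*-gap a (a′ ∷ Hi) B γ (a<a′ ∷ s) empty z a<z z<B with <-cmp z a′
... | tri< z<a′ _ _ =
  ·-emptyOn a (suc (toℕ z)) ((a′ ∷ Hi) ·* γ)
    (λ y a≤y y≤z → gap y a≤y (ℕ.≤-<-trans (ℕ.s≤s⁻¹ y≤z) z<a′) (ℕ.≤-<-trans (ℕ.s≤s⁻¹ y≤z) z<B))
    z a<z ℕ.≤-refl
  where gap = ·*-emptyOn-below a a′ Hi B γ s empty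
... | tri≈ _ refl _ =
  proj₁ (·-evicts a z ((z ∷ Hi) ·* γ) a<a′ (·-mem z (Hi ·* γ)) (λ y a≤y y<z → gap y a≤y y<z (ℕ.<-trans y<z z<B)))
  where gap = ·*-emptyOn-below a a′ Hi B γ s empty
... | tri> _ _ a′<z =
  trans (proj₂ (·-evicts a a′ ((a′ ∷ Hi) ·* γ) a<a′ (·-mem a′ (Hi ·* γ))
                         (λ y a≤y y<a′ → gap y a≤y y<a′ (ℕ.<-trans y<a′ (ℕ.<-trans a′<z z<B)))) z a′<z)
        (sorted-·*-gap a′ Hi B γ s (λ y a′≤y → empty y (ℕ.<⇒≤ (ℕ.<-≤-trans a<a′ a′≤y))) z a′<z z<B)
  where gap = ·*-emptyOn-below a a′ Hi B γ s empty

Separates : ∀ {n} → (Fin n → Set) → Fin n → ℕ → Column n → Set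
Separates U a B γ = (∀ z → U z → z < a → lookup γ z ≡ true) × EmptyOn a B γ

-- Enough test columns satisfying P to tell apart, below any window, the letters satisfying U.
Separating : ∀ {n} → (Column n → Set) → (Fin n → Set) → Set
Separating {n} P U = ∀ a → U a → ∀ B → toℕ a ℕ.< B → ∃ λ (γ : Column n) → P γ × Separates U a B γ

separating⇒⊆ : ∀ {n} {P : Column n → Set} {U} (u v : Word n) → Separating P U → All U u → All U v →
  (∀ γ → P γ → u ·* γ ≡ v ·* γ) → u ⊆ v
separating⇒⊆ u v sep Uu Uv u≈v {x} x∈u
  with any? (x ≟_) v | sep x (All.lookup Uu x∈u) (suc (toℕ x)) ℕ.≤-refl
... | yes x∈v | _ = x∈v
... | no  x∉v | γ , Pγ , contains , empty = ⊥-elim (true≢false (begin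
  true                ≡⟨ ·*-∈ u x γ (λ z∈ z<x → contains _ (All.lookup Uu z∈) z<x) x∈u ⟨
  lookup (u ·* γ) x   ≡⟨ cong (λ δ → lookup δ x) (u≈v γ Pγ) ⟩
  lookup (v ·* γ) x   ≡⟨ ·*-∉ v x γ (λ z∈ z<x → contains _ (All.lookup Uv z∈) z<x) x∉v ⟩
  lookup γ x          ≡⟨ empty x ℕ.≤-refl ℕ.≤-refl ⟩
  false               ∎))
  where
  open ≡-Reasoning
  true≢false : true ≢ false
  true≢false ()

sorted-drop : ∀ {n} (S : Row n) {R} → Sorted (S ++ R) → Sorted R
sorted-drop []      s = s
sorted-drop (_ ∷ S) s = sorted-drop S (Linked.tail s)

record Split {n} (R : Row n) (a : Fin n) : Set where
  constructor split
  field
    Lo : Row n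
    p  : Fin n
    Hi : Row n
    R≡ : R ≡ Lo ++ p ∷ a ∷ Hi

splitAt : ∀ {n} (R : Row n) a → Sorted R → a ∈ R → Exceeds R a → Split R a
splitAt (x ∷ R) x s (here refl) (w , w∈ , w<x) with w∈
... | here refl = ⊥-elim (<-irrefl refl w<x)
... | there w∈R = ⊥-elim (<-asym w<x (All.lookup (sorted⇒All> s) w∈R))
splitAt (x ∷ y ∷ R) a s (there (here refl)) _ = split [] x R refl
splitAt (x ∷ y ∷ R) a s (there (there a∈R)) _ with
  splitAt (y ∷ R) a (Linked.tail s) (there a∈R) (y , here refl , All.lookup (sorted⇒All> (Linked.tail s)) a∈R)
... | split Lo p Hi eq = split (x ∷ Lo) p Hi (cong (x ∷_) eq)

-- The letters of Lo are already present and act trivially, and the tail p a Hi empties [a, B).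
·*-separates : ∀ {n} (Lo : Row n) p a Hi B γ → let R = Lo ++ p ∷ a ∷ Hi in
  Sorted R → Separates (_∈ R) p B γ → Separates (_∈ R) a B (R ·* γ)
·*-separates Lo p a Hi B γ s (contains , empty) =
  subst (Separates (_∈ Lo ++ p ∷ a ∷ Hi) a B) (sym R·γ≡) (contains′ , empty′)
  where
  sTail = sorted-drop Lo s
  p<a = Linked.head sTail
  γ′ = (p ∷ a ∷ Hi) ·* γ
  lo-in : ∀ {z} → z ∈ Lo → lookup γ′ z ≡ true
  lo-in {z} z∈ = let z<p = All.lookup (sorted-++⇒All< Lo p (a ∷ Hi) s) z∈ in
    trans (·*-below (p ∷ a ∷ Hi) z γ (Linked⇒All <-trans z<p sTail)) (contains _ (∈-++⁺ˡ z∈) z<p)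
  R·γ≡ : (Lo ++ p ∷ a ∷ Hi) ·* γ ≡ γ′
  R·γ≡ = trans (·*-++ Lo (p ∷ a ∷ Hi) γ) (·*-fix Lo γ′ lo-in)
  contains′ : ∀ z → z ∈ Lo ++ p ∷ a ∷ Hi → z < a → lookup γ′ z ≡ true
  contains′ z z∈ z<a with ∈-++⁻ Lo z∈
  ... | inj₁ z∈Lo                 = lo-in z∈Lo
  ... | inj₂ (here refl)          = ·-mem p ((a ∷ Hi) ·* γ)
  ... | inj₂ (there (here refl))  = ⊥-elim (<-irrefl refl z<a)
  ... | inj₂ (there (there z∈Hi)) = ⊥-elim (<-asym z<a (All.lookup (sorted⇒All> (Linked.tail sTail)) z∈Hi))
  empty′ : EmptyOn a B γ′
  empty′ z a≤z z<B = sorted-·*-gap p (a ∷ Hi) B γ sTail empty z (ℕ.<-≤-trans p<a a≤z) z<B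

-- Test columns for the rows above R: the images under R of test columns for R.
separating-step : ∀ {n} {P : Column n → Set} {U} (R : Row n) → Sorted R → All U R → Separating P U →
  Separating (λ γ′ → ∃ λ γ → P γ × γ′ ≡ R ·* γ) (λ z → z ∈ R × Exceeds R z)
separating-step R s UR sep a (a∈ , a>) B a<B with splitAt R a s a∈ a>
... | split Lo p Hi refl with sep p (All.lookup UR (∈-++⁺ʳ Lo (here refl))) B
                                     (ℕ.<-trans (Linked.head (sorted-drop Lo s)) a<B)
...   | γ , Pγ , contains , empty =
  R ·* γ , (γ , Pγ , refl) , (λ z z∈ → contains′ z (proj₁ z∈)) , empty′
  where
  sep′ = ·*-separates Lo p a Hi B γ s ((λ z z∈ → contains z (All.lookup UR z∈)) , empty)
  contains′ = proj₁ sep′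
  empty′ = proj₂ sep′

reading-⊆ : ∀ {n} (R : Row n) T → Linked Stacked (R ∷ T) → reading (R ∷ T) ⊆ R
reading-⊆ R []      _                  z∈ = z∈
reading-⊆ R (S ∷ T) ((_ , S⊆R) ∷ lk) z∈ with ∈-++⁻ (reading (S ∷ T)) z∈
... | inj₁ z∈ST = S⊆R (reading-⊆ S T lk z∈ST)
... | inj₂ z∈R  = z∈R

reading-letters : ∀ {n} (R : Row n) T → All Sorted T → Linked Stacked (R ∷ T) →
  All (λ z → z ∈ R × Exceeds R z) (reading T)
reading-letters R []      _        _          = []
reading-letters R (S ∷ T) (sS ∷ _) (st ∷ lk) = All.tabulate (stacked-letters R S sS st ∘ reading-⊆ S T lk)

sorted-⊆-antisym : ∀ {n} (xs ys : Row n) → Sorted xs → Sorted ys → xs ⊆ ys → ys ⊆ xs → xs ≡ ys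
sorted-⊆-antisym []       []       _  _  _     _     = refl
sorted-⊆-antisym []       (y ∷ ys) _  _  _     ys⊆xs with ys⊆xs (here refl)
... | ()
sorted-⊆-antisym (x ∷ xs) []       _  _  xs⊆ys _     with xs⊆ys (here refl)
... | ()
sorted-⊆-antisym (x ∷ xs) (y ∷ ys) sx sy xs⊆ys ys⊆xs with heads (xs⊆ys (here refl)) (ys⊆xs (here refl))
  where
  heads : x ∈ y ∷ ys → y ∈ x ∷ xs → x ≡ y
  heads (here x≡y) _          = x≡y
  heads (there _)  (here y≡x) = sym y≡x
  heads (there x∈) (there y∈) = ⊥-elim (<-asym (All.lookup (sorted⇒All> sy) x∈) (All.lookup (sorted⇒All> sx) y∈))
... | refl = cong (x ∷_) (sorted-⊆-antisym xs ys (Linked.tail sx) (Linked.tail sy)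
  (λ z∈ → ∈-tail (All.lookup (sorted⇒All> sx) z∈) (xs⊆ys (there z∈)))
  (λ z∈ → ∈-tail (All.lookup (sorted⇒All> sy) z∈) (ys⊆xs (there z∈))))

reading-injective : ∀ {n} {P : Column n → Set} {U} (T S : Tableau n) → IsNTableau T → IsNTableau S →
  Separating P U → All U (reading T) → All U (reading S) →
  (∀ γ → P γ → reading T ·* γ ≡ reading S ·* γ) → T ≡ S
reading-injective []      []      _ _ _ _ _ _ = refl
reading-injective []      ([] ∷ S)      _ (() ∷ _ , _) _ _ _ _
reading-injective []      ((q ∷ Q) ∷ S) _ _ sep UT US T≈S
  with separating⇒⊆ (reading ((q ∷ Q) ∷ S)) [] sep US UT (λ γ Pγ → sym (T≈S γ Pγ)) (∈-++⁺ʳ (reading S) (here refl))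
... | ()
reading-injective ((r ∷ R) ∷ T) []      _ _ sep UT US T≈S
  with separating⇒⊆ (reading ((r ∷ R) ∷ T)) [] sep UT US T≈S (∈-++⁺ʳ (reading T) (here refl))
... | ()
reading-injective (R ∷ T) (Q ∷ S) (_ ∷ nesT , sR ∷ ssT , lkT) (_ ∷ nesS , sQ ∷ ssS , lkS) sep UT US T≈S
  with sorted-⊆-antisym R Q sR sQ
         (reading-⊆ Q S lkS ∘ separating⇒⊆ _ _ sep UT US T≈S ∘ ∈-++⁺ʳ (reading T))
         (reading-⊆ R T lkT ∘ separating⇒⊆ _ _ sep US UT (λ γ Pγ → sym (T≈S γ Pγ)) ∘ ∈-++⁺ʳ (reading S))
... | refl = cong (R ∷_)
  (reading-injective T S (nesT , ssT , Linked.tail lkT) (nesS , ssS , Linked.tail lkS)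
    (separating-step R sR (All.tabulate (All.lookup UT ∘ ∈-++⁺ʳ (reading T))) sep)
    (reading-letters R T ssT lkT) (reading-letters R S ssS lkS)
    λ { _ (γ , Pγ , refl) → begin
          reading T ·* R ·* γ  ≡⟨ ·*-++ (reading T) R γ ⟨
          reading (R ∷ T) ·* γ ≡⟨ T≈S γ Pγ ⟩
          reading (R ∷ S) ·* γ ≡⟨ ·*-++ (reading S) R γ ⟩
          reading S ·* R ·* γ  ∎ })
  where open ≡-Reasoning

initialSegment : ∀ {n} → ℕ → Column n
initialSegment {zero}  _       = []
initialSegment {suc n} zero    = false ∷ initialSegment zero
initialSegment {suc n} (suc k) = true ∷ initialSegment k

initialSegment-< : ∀ {n} k (z : Fin n) → toℕ z ℕ.< k → lookup (initialSegment k) z ≡ true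
initialSegment-< (suc k) zero    _         = refl
initialSegment-< (suc k) (suc z) (s≤s z<k) = initialSegment-< k z z<k

initialSegment-≥ : ∀ {n} k (z : Fin n) → k ℕ.≤ toℕ z → lookup (initialSegment k) z ≡ false
initialSegment-≥ zero    zero    _         = refl
initialSegment-≥ zero    (suc z) _         = initialSegment-≥ zero z z≤n
initialSegment-≥ (suc k) (suc z) (s≤s k≤z) = initialSegment-≥ k z k≤z

separating-initialSegment : ∀ {n} → Separating {n} (λ _ → ⊤) (λ _ → ⊤)
separating-initialSegment a _ _ _ =
  initialSegment (toℕ a) , tt , (λ z _ → initialSegment-< (toℕ a) z) , (λ z a≤z _ → initialSegment-≥ (toℕ a) z a≤z)

N-isNTableau : ∀ {n} (w : Word n) → IsNTableau (N w)
N-isNTableau w = weakNTableau⇒isNTableau (N w) (N-weakNTableau w)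

N-styl : ∀ {n} (u v : Word n) → N u ≡ N v → u ≡styl v
N-styl u v Nu≡Nv γ = begin
  act u γ                ≡⟨ act-N u γ ⟩
  reading (N u) ·* γ     ≡⟨ cong (λ T → reading T ·* γ) Nu≡Nv ⟩
  reading (N v) ·* γ     ≡⟨ act-N v γ ⟨
  act v γ                ∎
  where open ≡-Reasoning

styl-N : ∀ {n} (u v : Word n) → u ≡styl v → N u ≡ N v
styl-N u v u≡v = reading-injective (N u) (N v) (N-isNTableau u) (N-isNTableau v) separating-initialSegment
  (All.tabulate (λ _ → tt)) (All.tabulate (λ _ → tt))
  (λ γ _ → trans (sym (act-N u γ)) (trans (u≡v γ) (act-N v γ)))

theorem7p1 : (n : ℕ) →
    (∀ (w : Word n) → IsNTableau (N w)) ×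
    (∀ (u v : Word n) → (N u ≡ N v) ⇔ (u ≡styl v)) ×
    (∀ (T : Tableau n) → IsNTableau T → ∃ λ (w : Word n) → N w ≡ T)
theorem7p1 n = N-isNTableau , (λ u v → mk⇔ (N-styl u v) (styl-N u v)) , λ T isN → preimage T , N-preimage T isN
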